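{- Let $k$ be a positive integer and let $(x,y)$ be a vertex of the hexagonal grid $G_H$ with $x+y$ odd. Then for each vertex $v$ in $$\{(x-k+2j,\,y-k-1): j=0,1,\ldots,k\}\cup\{(x-k-1+2j,\,y+k): j=0,1,\ldots,k+1\}$$ there exists a path of length $2k+1$ in $G_H$ from $(x,y)$ to $v$.
   Context: The hexagonal grid $G_H$ (brick-wall representation) has vertex set $\mathbb{Z}\times\mathbb{Z}$; every vertex $(x,y)$ is adjacent to $(x-1,y)$ and $(x+1,y)$, and additionally to $(x,y+1)$ if $x+y$ is even, and to $(x,y-1)$ if $x+y$ is odd. -}

module Defs where

open import Data.Integer using (ℤ; _+_; _-_; +_)
open import Data.Integer.Properties using ()
open import Data.Nat using (ℕ; suc)
open import Data.Product using (_×_; _,_)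
open import Data.List using (List; []; _∷_; length; head; last)
open import Data.List.Relation.Unary.Unique.Propositional using (Unique)
open import Data.Maybe using (Maybe; just)
open import Relation.Binary.PropositionalEquality using (_≡_)

data Even : ℤ → Set where
  even : ∀ m → Even (m + m)

data Odd : ℤ → Set where
  odd : ∀ m → Odd (m + m + + 1)

Vertex : Set
Vertex = ℤ × ℤ

-- adjacency in the hexagonal grid G_H (brick-wall representation)
data Adj : Vertex → Vertex → Set where
  left  : ∀ x y → Adj (x , y) (x - + 1 , y)
  right : ∀ x y → Adj (x , y) (x + + 1 , y)
  up    : ∀ x y → Even (x + y) → Adj (x , y) (x , y + + 1)
  down  : ∀ x y → Odd (x + y) → Adj (x , y) (x , y - + 1)

data Chain : List Vertex → Set where
  []  : Chain []
  [_] : ∀ v → Chain (v ∷ [])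
  _∷_ : ∀ {u v vs} → Adj u v → Chain (v ∷ vs) → Chain (u ∷ v ∷ vs)

record Path (n : ℕ) (u w : Vertex) : Set where
  field
    vertices : List Vertex
    len      : length vertices ≡ suc n
    chain    : Chain vertices
    distinct : Unique vertices
    start    : head vertices ≡ just u
    end      : last vertices ≡ just w

data Target (k : ℕ) (x y : ℤ) : Vertex → Set where
  lower : ∀ j → j Data.Nat.≤ k →
          Target k x y (x - + k + (+ 2 Data.Integer.* + j) , y - + k - + 1)
  upper : ∀ j → j Data.Nat.≤ suc k →
          Target k x y (x - + k - + 1 + (+ 2 Data.Integer.* + j) , y + + k)

module Submission where

-- Every path built here is a staircase: it alternates a vertical edge with a
-- horizontal edge, so its height changes by one every second step.  Such a
-- path is automatically simple: if the vertices after the start are all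
-- strictly higher (with respect to a height function h) than the start, one may
-- prepend either a neighbour on the level of the start ("sidestep") or a
-- neighbour strictly below it ("climb") without repeating a vertex.  A rung,
-- sidestep followed by climb, restores the invariant, so iterating rungs gives
--   * ascending staircases from even vertices (height y), and
--   * descending staircases from odd vertices (height -y), ended by a down edge.
-- Parity bookkeeping rests on the fact that every edge of G_H joins an even
-- vertex to an odd one.  The lower targets are the ends of descending
-- staircases from (x , y); the upper targets are reached by one horizontal step
-- followed by an ascending staircase.

open import Defs
open import Data.Integer using (ℤ)
open import Data.Product using (_,_)

module Staircases where

  open import Data.Nat as ℕ using (ℕ; zero; suc)
  open import Data.Nat.Properties using (*-suc) renaming (+-comm to +-commℕ)
  open import Data.Integer using (+_; -_; _+_; _-_; _*_; _<_; _≤_)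
  open import Data.Integer.Properties
    using (+-assoc; +-comm; <⇒≢; <⇒≤; <-irrefl; ≤-refl; ≤-reflexive; <-≤-trans; suc[i]≤j⇒i<j; neg-mono-<)
  open import Data.Integer.Tactic.RingSolver using (solve-∀)
  open import Data.List using (List; []; _∷_; length; head; last)
  open import Data.List.Relation.Unary.All as All using (All; []; _∷_)
  open import Data.List.Relation.Unary.AllPairs using ([]; _∷_)
  open import Data.Maybe using (just)
  open import Data.Product using (Σ; proj₁; proj₂)
  open import Data.Sum using (_⊎_; inj₁; inj₂)
  open import Relation.Binary.PropositionalEquality
    using (_≡_; _≢_; refl; sym; trans; cong; cong₂; subst)

  i<i+1 : ∀ i → i < i + + 1
  i<i+1 i = suc[i]≤j⇒i<j (≤-reflexive (+-comm (+ 1) i))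

  i-1<i : ∀ i → i - + 1 < i
  i-1<i i = subst (i - + 1 <_) (cancel i) (i<i+1 (i - + 1))
    where
    cancel : ∀ i → i - + 1 + + 1 ≡ i
    cancel = solve-∀

  even+1 : ∀ {n} → Even n → Odd (n + + 1)
  even+1 (even m) = odd m

  even-1 : ∀ {n} → Even n → Odd (n - + 1)
  even-1 (even m) = subst Odd (regroup m) (odd (m - + 1))
    where
    regroup : ∀ m → (m - + 1) + (m - + 1) + + 1 ≡ m + m - + 1
    regroup = solve-∀

  odd+1 : ∀ {n} → Odd n → Even (n + + 1)
  odd+1 (odd m) = subst Even (regroup m) (even (m + + 1))
    where
    regroup : ∀ m → (m + + 1) + (m + + 1) ≡ m + m + + 1 + + 1
    regroup = solve-∀

  odd-1 : ∀ {n} → Odd n → Even (n - + 1)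
  odd-1 (odd m) = subst Even (regroup m) (even m)
    where
    regroup : ∀ m → m + m ≡ m + m + + 1 - + 1
    regroup = solve-∀

  coordsum : Vertex → ℤ
  coordsum (x , y) = x + y

  shiftˣ : ∀ x y c → (x + c) + y ≡ (x + y) + c
  shiftˣ = solve-∀

  even→odd : ∀ {u v} → Adj u v → Even (coordsum u) → Odd (coordsum v)
  even→odd (left x y)   e = subst Odd (sym (shiftˣ x y (- + 1))) (even-1 e)
  even→odd (right x y)  e = subst Odd (sym (shiftˣ x y (+ 1))) (even+1 e)
  even→odd (up x y _)   e = subst Odd (+-assoc x y (+ 1)) (even+1 e)
  even→odd (down x y _) e = subst Odd (+-assoc x y (- + 1)) (even-1 e)

  odd→even : ∀ {u v} → Adj u v → Odd (coordsum u) → Even (coordsum v)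
  odd→even (left x y)   o = subst Even (sym (shiftˣ x y (- + 1))) (odd-1 o)
  odd→even (right x y)  o = subst Even (sym (shiftˣ x y (+ 1))) (odd+1 o)
  odd→even (up x y _)   o = subst Even (+-assoc x y (+ 1)) (odd+1 o)
  odd→even (down x y _) o = subst Even (+-assoc x y (- + 1)) (odd-1 o)

  adj⇒≢ : ∀ {u v} → Adj u v → u ≢ v
  adj⇒≢ (left x y)   eq = <⇒≢ (i-1<i x) (sym (cong proj₁ eq))
  adj⇒≢ (right x y)  eq = <⇒≢ (i<i+1 x) (cong proj₁ eq)
  adj⇒≢ (up x y _)   eq = <⇒≢ (i<i+1 y) (cong proj₂ eq)
  adj⇒≢ (down x y _) eq = <⇒≢ (i-1<i y) (sym (cong proj₂ eq))

  cast : ∀ {n n' u w w'} → n ≡ n' → w ≡ w' → Path n u w → Path n' u w'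
  cast refl refl p = p

  extend : ∀ {n u v w} → Adj u v → (p : Path n v w) → All (u ≢_) (Path.vertices p) →
           Path (suc n) u w
  extend {n} {u} {v} adj p fresh = record
    { vertices = u ∷ vertices
    ; len      = cong suc len
    ; chain    = link start chain
    ; distinct = fresh ∷ distinct
    ; start    = refl
    ; end      = trans (last-cons vertices len) end
    }
    where
    open Path p
    link : ∀ {vs} → head vs ≡ just v → Chain vs → Chain (u ∷ vs)
    link {[]}    ()
    link {_ ∷ _} refl c = adj ∷ c
    last-cons : ∀ vs → length vs ≡ suc n → last (u ∷ vs) ≡ last vs
    last-cons []      ()
    last-cons (_ ∷ _) _ = refl

  Above : ∀ {n u w} → (Vertex → ℤ) → Path n u w → Set
  Above {u = u} h p = All (λ v → h u ≤ h v) (Path.vertices p)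

  Rising : ∀ {n u w} → (Vertex → ℤ) → Path n u w → Set
  Rising {u = u} h p = All (λ v → v ≡ u ⊎ h u < h v) (Path.vertices p)

  RisingPath : (Vertex → ℤ) → ℕ → Vertex → Vertex → Set
  RisingPath h n u w = Σ (Path n u w) (Rising h)

  recast : ∀ {h n n' u w w'} → n ≡ n' → w ≡ w' → RisingPath h n u w → RisingPath h n' u w'
  recast refl refl p = p

  lower⇒≢ : ∀ {h : Vertex → ℤ} {u v} → h u < h v → u ≢ v
  lower⇒≢ lt refl = <-irrefl refl lt

  single : ∀ {h} v → RisingPath h 0 v v
  single v = record
    { vertices = v ∷ []
    ; len      = refl
    ; chain    = [ v ]
    ; distinct = [] ∷ []
    ; start    = refl
    ; end      = refl
    } , inj₁ refl ∷ []

  rising⇒above : ∀ {h n u w} → RisingPath h n u w → Σ (Path n u w) (Above h)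
  rising⇒above (p , rising) = p , All.map (λ { (inj₁ refl) → ≤-refl ; (inj₂ lt) → <⇒≤ lt }) rising

  -- Sidestep: prepend a neighbour on the level of the start of a rising path.
  -- Only the start shares that level, and it is distinct from the neighbour.
  sidestep : ∀ {h n u w₀ w} → Adj u w₀ → h u ≡ h w₀ → RisingPath h n w₀ w →
             Σ (Path (suc n) u w) (Above h)
  sidestep {h} {u = u} {w₀} adj level (p , rising) =
    extend adj p (All.map fresh rising) , ≤-refl ∷ All.map not-below rising
    where
    fresh : ∀ {v} → v ≡ w₀ ⊎ h w₀ < h v → u ≢ v
    fresh     (inj₁ refl) = adj⇒≢ adj
    fresh {v} (inj₂ lt)   = lower⇒≢ {h} (subst (_< h v) (sym level) lt)
    not-below : ∀ {v} → v ≡ w₀ ⊎ h w₀ < h v → h u ≤ h v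
    not-below     (inj₁ refl) = ≤-reflexive level
    not-below {v} (inj₂ lt)   = <⇒≤ (subst (_< h v) (sym level) lt)

  climb : ∀ {h n u w₀ w} → Adj u w₀ → h u < h w₀ → Σ (Path n w₀ w) (Above h) →
          RisingPath h (suc n) u w
  climb {h} adj lt (p , above) =
      extend adj p (All.map (λ le → lower⇒≢ {h} (<-≤-trans lt le)) above)
    , inj₁ refl ∷ All.map (λ le → inj₂ (<-≤-trans lt le)) above

  rung : ∀ {h n u u' w₀ w} → Adj u u' → Adj u' w₀ → h u < h u' → h u' ≡ h w₀ →
         RisingPath h n w₀ w → RisingPath h (suc (suc n)) u w
  rung vertical horizontal rise level rest = climb vertical rise (sidestep horizontal level rest)

  height depth : Vertex → ℤ
  height (_ , y) = y
  depth  (_ , y) = - y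

  x-right : ∀ a R L → (a + + 1) + R - L ≡ a + (+ 1 + R) - L
  x-right = solve-∀
  x-left : ∀ a R L → (a - + 1) + R - L ≡ a + R - (+ 1 + L)
  x-left = solve-∀
  y-up : ∀ b M → (b + + 1) + M ≡ b + (+ 1 + M)
  y-up = solve-∀
  y-down : ∀ b M → (b - + 1) - M - + 1 ≡ b - (+ 1 + M) - + 1
  y-down = solve-∀
  x-start : ∀ a → a ≡ a + + 0 - + 0
  x-start = solve-∀
  y-start : ∀ b → b ≡ b + + 0
  y-start = solve-∀

  two-more : ∀ m → suc (suc (2 ℕ.* m)) ≡ 2 ℕ.* suc m
  two-more m = sym (*-suc 2 m)

  ascend : ∀ r l a b → Even (a + b) →
           RisingPath height (2 ℕ.* (r ℕ.+ l)) (a , b) (a + + r - + l , b + + (r ℕ.+ l))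
  ascend zero zero a b _ =
    recast refl (cong₂ _,_ (x-start a) (y-start b)) (single (a , b))
  ascend (suc r) l a b e =
    recast (two-more (r ℕ.+ l)) (cong₂ _,_ (x-right a (+ r) (+ l)) (y-up b (+ (r ℕ.+ l))))
      (rung (up a b e) (right a (b + + 1)) (i<i+1 b) refl
        (ascend r l (a + + 1) (b + + 1) (odd→even (right a (b + + 1)) (even→odd (up a b e) e))))
  ascend zero (suc l) a b e =
    recast (two-more l) (cong₂ _,_ (x-left a (+ 0) (+ l)) (y-up b (+ l)))
      (rung (up a b e) (left a (b + + 1)) (i<i+1 b) refl
        (ascend zero l (a - + 1) (b + + 1) (odd→even (left a (b + + 1)) (even→odd (up a b e) e))))

  descend : ∀ r l a b → Odd (a + b) →
            RisingPath depth (suc (2 ℕ.* (r ℕ.+ l))) (a , b) (a + + r - + l , b - + (r ℕ.+ l) - + 1)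
  descend zero zero a b o =
    recast refl (cong₂ _,_ (x-start a) (cong (_- + 1) (y-start b)))
      (climb (down a b o) (neg-mono-< (i-1<i b)) (rising⇒above {depth} (single (a , b - + 1))))
  descend (suc r) l a b o =
    recast (cong suc (two-more (r ℕ.+ l))) (cong₂ _,_ (x-right a (+ r) (+ l)) (y-down b (+ (r ℕ.+ l))))
      (rung (down a b o) (right a (b - + 1)) (neg-mono-< (i-1<i b)) refl
        (descend r l (a + + 1) (b - + 1) (even→odd (right a (b - + 1)) (odd→even (down a b o) o))))
  descend zero (suc l) a b o =
    recast (cong suc (two-more l)) (cong₂ _,_ (x-left a (+ 0) (+ l)) (y-down b (+ l)))
      (rung (down a b o) (left a (b - + 1)) (neg-mono-< (i-1<i b)) refl
        (descend zero l (a - + 1) (b - + 1) (even→odd (left a (b - + 1)) (odd→even (down a b o) o))))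

  x-lower : ∀ x J L → x + J - L ≡ x - (J + L) + (+ 2 * J)
  x-lower = solve-∀
  x-upper-left : ∀ x K → (x - + 1) + + 0 - K ≡ x - K - + 1 + (+ 2 * + 0)
  x-upper-left = solve-∀
  x-upper-right : ∀ x J L → (x + + 1) + J - L ≡ x - (J + L) - + 1 + (+ 2 * (+ 1 + J))
  x-upper-right = solve-∀

  lower-path : ∀ j l x y → Odd (x + y) →
               Path (2 ℕ.* (j ℕ.+ l) ℕ.+ 1) (x , y)
                    (x - + (j ℕ.+ l) + (+ 2 * + j) , y - + (j ℕ.+ l) - + 1)
  lower-path j l x y o =
    cast (+-commℕ 1 (2 ℕ.* (j ℕ.+ l))) (cong₂ _,_ (x-lower x (+ j) (+ l)) refl)
      (proj₁ (descend j l x y o))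

  upper-path-left : ∀ k x y → Odd (x + y) →
                    Path (2 ℕ.* k ℕ.+ 1) (x , y) (x - + k - + 1 + (+ 2 * + 0) , y + + k)
  upper-path-left k x y o =
    cast (+-commℕ 1 (2 ℕ.* k)) (cong₂ _,_ (x-upper-left x (+ k)) refl)
      (proj₁ (sidestep (left x y) refl (ascend 0 k (x - + 1) y (odd→even (left x y) o))))

  upper-path-right : ∀ j l x y → Odd (x + y) →
                     Path (2 ℕ.* (j ℕ.+ l) ℕ.+ 1) (x , y)
                          (x - + (j ℕ.+ l) - + 1 + (+ 2 * + suc j) , y + + (j ℕ.+ l))
  upper-path-right j l x y o =
    cast (+-commℕ 1 (2 ℕ.* (j ℕ.+ l))) (cong₂ _,_ (x-upper-right x (+ j) (+ l)) refl)
      (proj₁ (sidestep (right x y) refl (ascend j l (x + + 1) y (odd→even (right x y) o))))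

open Staircases using (lower-path; upper-path-left; upper-path-right)

open import Data.Nat using (ℕ; NonZero; _+_; _*_)
open import Data.Nat using (zero; suc; s≤s⁻¹)
open import Data.Nat.Properties using (m≤n⇒∃[o]m+o≡n)
open import Relation.Binary.PropositionalEquality using (refl)

claim7 : (k : ℕ) → .{{NonZero k}} → (x y : ℤ) → Odd (x Data.Integer.+ y) →
         (v : Vertex) → Target k x y v → Path (2 * k + 1) (x , y) v
claim7 k x y odd-xy _ (lower j j≤k) with m≤n⇒∃[o]m+o≡n j≤k
... | l , refl = lower-path j l x y odd-xy
claim7 k x y odd-xy _ (upper zero _) = upper-path-left k x y odd-xy
claim7 k x y odd-xy _ (upper (suc j) j+1≤k+1) with m≤n⇒∃[o]m+o≡n (s≤s⁻¹ j+1≤k+1)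
... | l , refl = upper-path-right j l x y odd-xy
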